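{- For every duplicative forest $\mathfrak{f}$, the poset $\mathcal{D}^*(\mathfrak{f}) = \{\mathfrak{f}' : \mathfrak{f} \ll \mathfrak{f}'\}$ is isomorphic to a maximal interval of a Mockingbird lattice, i.e. there exist $d \geq 0$ and an element $\mathfrak{a}$ of $\mathrm{M}(d)$ such that $\mathcal{D}^*(\mathfrak{f})$ is isomorphic as a poset to the interval $\{\mathfrak{u} \in \mathrm{M}(d) : \mathfrak{a} \preccurlyeq \mathfrak{u}\}$ (the interval from $\mathfrak{a}$ to the greatest element of $\mathrm{M}(d)$).
   Context: Duplicative trees and forests are defined mutually: a duplicative forest is a finite word $\mathfrak{f}(1)\cdots\mathfrak{f}(\ell)$ ($\ell\ge 0$) of duplicative trees (the empty word $\epsilon$ is the empty forest), and a duplicative tree is $\circ(\mathfrak{g})$ or $\bullet(\mathfrak{g})$ for a duplicative forest $\mathfrak{g}$, i.e. a planar rooted tree whose nodes are each white ($\circ$) or black ($\bullet$), with root of that color and the trees of $\mathfrak{g}$ as subtrees of the root. Concatenation of forests is written $\cdot$. The relation $\lessdot$ on forests: $\mathfrak{f} \lessdot \mathfrak{f}'$ iff $\mathfrak{f}'$ is obtained from $\mathfrak{f}$ by choosing one white node, whose subtree is $\circ(\mathfrak{g})$, and replacing this subtree by $\bullet(\mathfrak{g}\cdot\mathfrak{g})$ (turn the node black and duplicate its sequence of child subtrees). $\ll$ is the reflexive transitive closure of $\lessdot$; it is a partial order. Terms over $\{\mathsf{M}\}$: variables $\mathsf{x}_i$, the constant $\mathsf{M}$, and applications $\mathfrak{t}_1\mathfrak{t}_2$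 (binary trees; juxtaposition left-associative). $\mathfrak{t}\Rightarrow\mathfrak{t}'$ iff $\mathfrak{t}'$ is obtained from $\mathfrak{t}$ by replacing one subterm $\mathsf{M}\mathfrak{s}$ by $\mathfrak{s}\mathfrak{s}$; $\preccurlyeq$ is the reflexive transitive closure of $\Rightarrow$ (a partial order). For a term $\mathfrak{t}$, $\mathcal{P}(\mathfrak{t})$ is the poset $\{\mathfrak{t}' : \mathfrak{t}\preccurlyeq\mathfrak{t}'\}$. The Mockingbird lattice of order $d\ge0$ is $\mathrm{M}(d) := \mathcal{P}(\mathfrak{r}_d)$ where $\mathfrak{r}_0 := \mathsf{M}$ and $\mathfrak{r}_d := \mathsf{M}\mathfrak{r}_{d-1}$ for $d\ge1$; it is a finite lattice. -}

module Defs where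

open import Data.Nat using (ℕ; zero; suc)
open import Data.List using (List; []; _∷_; _++_)
open import Data.Product using (_×_)
open import Relation.Binary.PropositionalEquality using (_≡_)
open import Relation.Binary.Construct.Closure.ReflexiveTransitive using (Star)

data Color : Set where
  white black : Color

data Tree : Set where
  node : Color → List Tree → Tree

Forest : Set
Forest = List Tree

mutual
  data _⋖T_ : Tree → Tree → Set where
    dup   : ∀ (g : Forest) → node white g ⋖T node black (g ++ g)
    below : ∀ {c : Color} {g g' : Forest} → g ⋖F g' → node c g ⋖T node c g'

  data _⋖F_ : Forest → Forest → Set where
    here  : ∀ {t t' : Tree} {f : Forest} → t ⋖T t' → (t ∷ f) ⋖F (t' ∷ f)
    there : ∀ {t : Tree} {f f' : Forest} → f ⋖F f' → (t ∷ f) ⋖F (t ∷ f')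

_≪_ : Forest → Forest → Set
_≪_ = Star _⋖F_

infixl 9 _·_
data Term : Set where
  var : ℕ → Term
  M   : Term
  _·_ : Term → Term → Term

data _⇒_ : Term → Term → Set where
  root  : ∀ (s : Term) → (M · s) ⇒ (s · s)
  left  : ∀ {t t' : Term} (s : Term) → t ⇒ t' → (t · s) ⇒ (t' · s)
  right : ∀ {s s' : Term} (t : Term) → s ⇒ s' → (t · s) ⇒ (t · s')

_≼_ : Term → Term → Set
_≼_ = Star _⇒_

-- r_0 = M, r_{d+1} = M r_d ; M(d) = { t : r_d ≼ t }
r : ℕ → Term
r zero    = M
r (suc d) = M · r d

-- Poset isomorphism between D*(f) = { f' : f ≪ f' } (ordered by ≪)
-- and the interval [a, top] of M(d) = { u : r d ≼ u , a ≼ u }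
-- (ordered by ≼): mutually inverse maps between the carriers which
-- preserve and reflect the orders.

record DStar≅Interval (f : Forest) (d : ℕ) (a : Term) : Set where
  field
    to      : Forest → Term
    from    : Term → Forest
    to-in-M   : ∀ f' → f ≪ f' → r d ≼ to f'
    to-in     : ∀ f' → f ≪ f' → a ≼ to f'
    from-in   : ∀ u → r d ≼ u → a ≼ u → f ≪ from u
    from-to   : ∀ f' → f ≪ f' → from (to f') ≡ f'
    to-from   : ∀ u → r d ≼ u → a ≼ u → to (from u) ≡ u
    mono      : ∀ f₁ f₂ → f ≪ f₁ → f ≪ f₂ → f₁ ≪ f₂ → to f₁ ≼ to f₂
    reflect   : ∀ f₁ f₂ → f ≪ f₁ → f ≪ f₂ → to f₁ ≼ to f₂ → f₁ ≪ f₂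

{-# OPTIONS --safe #-}

-- Encode a forest as a term of M(n), n at least its depth: a forest t g becomes the
-- application of (the encoding of) t to that of g, a white node ∘g becomes M g, a black
-- node becomes the application of the two halves of its children, and the empty forest
-- becomes the top of M(n), which only rewrites to itself. Duplicating a white node is
-- then literally the rewrite M s ⇒ s s, so the encoding is monotone, and conversely
-- every rewrite of an encoded term is the image of a duplication step (or of no step),
-- so the encoding maps D*(f) onto the interval above the encoding of f. It is injective
-- there because every forest above f is f with some white nodes duplicated, which lets
-- a term be decoded relative to f.

module Submission where

open import Defs
open import Data.Nat using (ℕ; zero; suc; _+_; _⊔_; _⊓_; ⌊_/2⌋; _≤_; _<_; z≤n; s≤s)
open import Data.Nat.Properties
  using (n≡⌊n+n/2⌋; ⌊n/2⌋≤n; ≤-refl; ≤-trans; <⇒≱; m≤n⇒m≤1+n; m≤n⊔m; ⊔-monoʳ-≤;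
         m⊔n≤o⇒m≤o; m⊔n≤o⇒n≤o; m≤n⇒m⊓n≡m)
open import Data.Product using (Σ; ∃-syntax; _×_; _,_)
open import Data.Sum using (_⊎_; inj₁; inj₂)
open import Data.Empty using (⊥-elim)
open import Data.List using (List; []; _∷_; _++_; length; take; drop)
open import Data.List.Properties using (length-++; length-take; take++drop≡id)
open import Relation.Nullary using (¬_)
open import Relation.Binary.PropositionalEquality
open import Relation.Binary.Construct.Closure.ReflexiveTransitive
  using (Star; ε; _◅_; _◅◅_; gmap; kleisliStar)

open ≡-Reasoning

take-length-++ : ∀ {A : Set} (a b : List A) → take (length a) (a ++ b) ≡ a
take-length-++ []      b = refl
take-length-++ (x ∷ a) b = cong (x ∷_) (take-length-++ a b)

drop-length-++ : ∀ {A : Set} (a b : List A) → drop (length a) (a ++ b) ≡ b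
drop-length-++ []      b = refl
drop-length-++ (x ∷ a) b = drop-length-++ a b

half : ∀ {A : Set} → List A → ℕ
half h = ⌊ length h /2⌋

record Halves {A : Set} (a b : List A) : Set where
  constructor mkHalves
  field length≡half : length a ≡ half (a ++ b)

halves-take-drop : ∀ {A : Set} (h : List A) → Halves (take (half h) h) (drop (half h) h)
halves-take-drop h = mkHalves (begin
  length (take (half h) h)                 ≡⟨ length-take (half h) h ⟩
  half h ⊓ length h                        ≡⟨ m≤n⇒m⊓n≡m (⌊n/2⌋≤n (length h)) ⟩
  half h                                   ≡⟨ cong half (take++drop≡id (half h) h) ⟨
  half (take (half h) h ++ drop (half h) h) ∎)

halves-dup : ∀ {A : Set} (g : List A) → Halves g g
halves-dup g = mkHalves (trans (n≡⌊n+n/2⌋ (length g)) (cong ⌊_/2⌋ (sym (length-++ g))))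

halves-resp-length : ∀ {A : Set} {a b a' b' : List A} →
  length a ≡ length a' → length b ≡ length b' → Halves a b → Halves a' b'
halves-resp-length {a = a} {b} {a'} {b'} eqa eqb (mkHalves hv) =
  mkHalves (trans (sym eqa) (trans hv (cong ⌊_/2⌋ (begin
    length (a ++ b)        ≡⟨ length-++ a ⟩
    length a + length b    ≡⟨ cong₂ _+_ eqa eqb ⟩
    length a' + length b'  ≡⟨ length-++ a' ⟨
    length (a' ++ b')      ∎))))

data HalvesView {A : Set} : List A → Set where
  halves : (a b : List A) → Halves a b → HalvesView (a ++ b)

halvesView : ∀ {A : Set} (h : List A) → HalvesView h
halvesView {A} h = subst (HalvesView {A}) (take++drop≡id (half h) h)
  (halves (take (half h) h) (drop (half h) h) (halves-take-drop h))

·-monoˡ-≼ : ∀ {s s'} v → s ≼ s' → (s · v) ≼ (s' · v)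
·-monoˡ-≼ v = gmap (_· v) (left v)

·-monoʳ-≼ : ∀ s {v v'} → v ≼ v' → (s · v) ≼ (s · v')
·-monoʳ-≼ s = gmap (s ·_) (right s)

·-mono-≼ : ∀ {s s' v v'} → s ≼ s' → v ≼ v' → (s · v) ≼ (s' · v')
·-mono-≼ {s' = s'} {v} p q = ·-monoˡ-≼ v p ◅◅ ·-monoʳ-≼ s' q

·-⇒-inv : ∀ {s v u} → ¬ s ≡ M → (s · v) ⇒ u →
  (∃[ s' ] s ⇒ s' × u ≡ s' · v) ⊎ (∃[ v' ] v ⇒ v' × u ≡ s · v')
·-⇒-inv s≢M (root _)     = ⊥-elim (s≢M refl)
·-⇒-inv _   (left _ st)  = inj₁ (_ , st , refl)
·-⇒-inv _   (right _ st) = inj₂ (_ , st , refl)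

top : ℕ → Term
top zero    = M
top (suc n) = top n · top n

r≼top : ∀ n → r n ≼ top n
r≼top zero    = ε
r≼top (suc n) = root (r n) ◅ ·-mono-≼ (r≼top n) (r≼top n)

top-⇒ : ∀ n {u} → top n ⇒ u → u ≡ top n
top-⇒ zero          ()
top-⇒ (suc zero)    (root _)     = refl
top-⇒ (suc (suc n)) (left _ st)  = cong (_· top (suc n)) (top-⇒ (suc n) st)
top-⇒ (suc (suc n)) (right _ st) = cong (top (suc n) ·_) (top-⇒ (suc n) st)

_≪ᵗ_ : Tree → Tree → Set
_≪ᵗ_ = Star _⋖T_

node-≪ : ∀ c {g g'} → g ≪ g' → node c g ≪ᵗ node c g'
node-≪ c = gmap (node c) below

∷-≪ˡ : ∀ {t t'} g → t ≪ᵗ t' → (t ∷ g) ≪ (t' ∷ g)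
∷-≪ˡ g = gmap (_∷ g) here

∷-≪ʳ : ∀ t {g g'} → g ≪ g' → (t ∷ g) ≪ (t ∷ g')
∷-≪ʳ t = gmap (t ∷_) there

⋖-length : ∀ {g g'} → g ⋖F g' → length g ≡ length g'
⋖-length (here _)  = refl
⋖-length (there p) = cong suc (⋖-length p)

≪-length : ∀ {g g'} → g ≪ g' → length g ≡ length g'
≪-length ε        = refl
≪-length (p ◅ ps) = trans (⋖-length p) (≪-length ps)

⋖-++⁺ˡ : ∀ {a a'} b → a ⋖F a' → (a ++ b) ⋖F (a' ++ b)
⋖-++⁺ˡ b (here p)  = here p
⋖-++⁺ˡ b (there p) = there (⋖-++⁺ˡ b p)

⋖-++⁺ʳ : ∀ a {b b'} → b ⋖F b' → (a ++ b) ⋖F (a ++ b')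
⋖-++⁺ʳ []      p = p
⋖-++⁺ʳ (t ∷ a) p = there (⋖-++⁺ʳ a p)

≪-++⁺ˡ : ∀ {a a'} b → a ≪ a' → (a ++ b) ≪ (a' ++ b)
≪-++⁺ˡ b = gmap (_++ b) (⋖-++⁺ˡ b)

≪-++⁺ʳ : ∀ a {b b'} → b ≪ b' → (a ++ b) ≪ (a ++ b')
≪-++⁺ʳ a = gmap (a ++_) (⋖-++⁺ʳ a)

⋖-++⁻ : ∀ a {b x} → (a ++ b) ⋖F x →
  (∃[ a' ] a ⋖F a' × x ≡ a' ++ b) ⊎ (∃[ b' ] b ⋖F b' × x ≡ a ++ b')
⋖-++⁻ []      p         = inj₂ (_ , p , refl)
⋖-++⁻ (t ∷ a) (here p)  = inj₁ (_ , here p , refl)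
⋖-++⁻ (t ∷ a) (there p) with ⋖-++⁻ a p
... | inj₁ (a' , q , refl) = inj₁ (t ∷ a' , there q , refl)
... | inj₂ (b' , q , refl) = inj₂ (b' , q , refl)

mutual
  encodeT : ℕ → Tree → Term
  encodeT zero    _              = M
  encodeT (suc n) (node white g) = M · encodeF n g
  encodeT (suc n) (node black h) = encodeF n (take (half h) h) · encodeF n (drop (half h) h)

  encodeF : ℕ → Forest → Term
  encodeF zero    _       = M
  encodeF (suc n) []      = top (suc n)
  encodeF (suc n) (t ∷ g) = encodeT n t · encodeF n g

encodeT-halves : ∀ n {a b} → Halves a b →
  encodeT (suc n) (node black (a ++ b)) ≡ encodeF n a · encodeF n b
encodeT-halves n {a} {b} (mkHalves hv) = cong₂ (λ x y → encodeF n x · encodeF n y)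
  (trans (cong (λ k → take k (a ++ b)) (sym hv)) (take-length-++ a b))
  (trans (cong (λ k → drop k (a ++ b)) (sym hv)) (drop-length-++ a b))

encodeT-dup : ∀ n g → encodeT (suc n) (node black (g ++ g)) ≡ encodeF n g · encodeF n g
encodeT-dup n g = encodeT-halves n (halves-dup g)

encodeT-≢M : ∀ n t → ¬ encodeT (suc n) t ≡ M
encodeT-≢M n (node white _) ()
encodeT-≢M n (node black _) ()

encodeF-≢M : ∀ n f → ¬ encodeF (suc n) f ≡ M
encodeF-≢M n []      ()
encodeF-≢M n (_ ∷ _) ()

mutual
  r≼encodeT : ∀ n t → r n ≼ encodeT n t
  r≼encodeT zero    _              = ε
  r≼encodeT (suc n) (node white g) = ·-monoʳ-≼ M (r≼encodeF n g)
  r≼encodeT (suc n) (node black h) = root (r n) ◅ ·-mono-≼ (r≼encodeF n _) (r≼encodeF n _)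

  r≼encodeF : ∀ n f → r n ≼ encodeF n f
  r≼encodeF zero    _       = ε
  r≼encodeF (suc n) []      = r≼top (suc n)
  r≼encodeF (suc n) (t ∷ g) = root (r n) ◅ ·-mono-≼ (r≼encodeT n t) (r≼encodeF n g)

encodeT-black-mono : ∀ n {a b a' b'} → Halves a b → Halves a' b' →
  encodeF n a ≼ encodeF n a' → encodeF n b ≼ encodeF n b' →
  encodeT (suc n) (node black (a ++ b)) ≼ encodeT (suc n) (node black (a' ++ b'))
encodeT-black-mono n hv hv' p q =
  subst₂ _≼_ (sym (encodeT-halves n hv)) (sym (encodeT-halves n hv')) (·-mono-≼ p q)

mutual
  encodeT-mono : ∀ n {t t'} → t ⋖T t' → encodeT n t ≼ encodeT n t'
  encodeT-mono zero    _     = ε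
  encodeT-mono (suc n) (dup g) =
    subst ((M · encodeF n g) ≼_) (sym (encodeT-dup n g)) (root (encodeF n g) ◅ ε)
  encodeT-mono (suc n) (below {white} p) = ·-monoʳ-≼ M (encodeF-mono n p)
  encodeT-mono (suc n) (below {black} {h} p) with halvesView h
  ... | halves a b hv with ⋖-++⁻ a p
  ...   | inj₁ (_ , q , refl) =
    encodeT-black-mono n hv (halves-resp-length (⋖-length q) refl hv) (encodeF-mono n q) ε
  ...   | inj₂ (_ , q , refl) =
    encodeT-black-mono n hv (halves-resp-length refl (⋖-length q) hv) ε (encodeF-mono n q)

  encodeF-mono : ∀ n {f f'} → f ⋖F f' → encodeF n f ≼ encodeF n f'
  encodeF-mono zero    _         = ε
  encodeF-mono (suc n) (here p)  = ·-monoˡ-≼ _ (encodeT-mono n p)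
  encodeF-mono (suc n) (there p) = ·-monoʳ-≼ _ (encodeF-mono n p)

encodeF-mono⋆ : ∀ n {f f'} → f ≪ f' → encodeF n f ≼ encodeF n f'
encodeF-mono⋆ n = kleisliStar (encodeF n) (encodeF-mono n)

-- Every rewrite of an encoded term comes from a duplication

mutual
  encodeT-lift : ∀ n t {u} → encodeT n t ⇒ u → ∃[ t' ] t ≪ᵗ t' × encodeT n t' ≡ u
  encodeT-lift zero _ ()
  encodeT-lift (suc n) (node white g) (root _) = node black (g ++ g) , dup g ◅ ε , encodeT-dup n g
  encodeT-lift (suc n) (node white g) (right _ st) with encodeF-lift n g st
  ... | g' , p , refl = node white g' , node-≪ white p , refl
  encodeT-lift (suc n) (node black h) {u} st with halvesView h
  ... | halves a b hv = encodeT-black-lift n hv (subst (_⇒ u) (encodeT-halves n hv) st)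

  encodeT-black-lift : ∀ n {a b u} → Halves a b → (encodeF n a · encodeF n b) ⇒ u →
    ∃[ t' ] node black (a ++ b) ≪ᵗ t' × encodeT (suc n) t' ≡ u
  encodeT-black-lift zero _ (root _) = _ , ε , refl
  encodeT-black-lift (suc n) {a} {b} hv st with ·-⇒-inv (encodeF-≢M n a) st
  ... | inj₁ (_ , st₁ , refl) with encodeF-lift (suc n) a st₁
  ...   | a' , p , refl = node black (a' ++ b) , node-≪ black (≪-++⁺ˡ b p) ,
    encodeT-halves (suc n) {a'} (halves-resp-length (≪-length p) refl hv)
  encodeT-black-lift (suc n) {a} {b} hv st | inj₂ (_ , st₂ , refl) with encodeF-lift (suc n) b st₂
  ...   | b' , p , refl = node black (a ++ b') , node-≪ black (≪-++⁺ʳ a p) ,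
    encodeT-halves (suc n) {a} {b'} (halves-resp-length refl (≪-length p) hv)

  encodeF-lift : ∀ n f {u} → encodeF n f ⇒ u → ∃[ f' ] f ≪ f' × encodeF n f' ≡ u
  encodeF-lift zero _ ()
  encodeF-lift (suc n) [] st = [] , ε , sym (top-⇒ (suc n) st)
  encodeF-lift (suc zero) (t ∷ g) (root _) = t ∷ g , ε , refl
  encodeF-lift (suc (suc n)) (t ∷ g) st with ·-⇒-inv (encodeT-≢M n t) st
  ... | inj₁ (_ , st₁ , refl) with encodeT-lift (suc n) t st₁
  ...   | t' , p , refl = t' ∷ g , ∷-≪ˡ g p , refl
  encodeF-lift (suc (suc n)) (t ∷ g) st | inj₂ (_ , st₂ , refl) with encodeF-lift (suc n) g st₂
  ...   | g' , p , refl = t ∷ g' , ∷-≪ʳ t p , refl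

encodeF-lift⋆ : ∀ n f {u} → encodeF n f ≼ u → ∃[ f' ] f ≪ f' × encodeF n f' ≡ u
encodeF-lift⋆ n f ε = f , ε , refl
encodeF-lift⋆ n f (st ◅ sts) with encodeF-lift n f st
... | f₁ , p , refl with encodeF-lift⋆ n f₁ sts
...   | f' , q , e = f' , p ◅◅ q , e

-- The shape of the forests above a given one

mutual
  data _⊑ᵗ_ : Tree → Tree → Set where
    same       : ∀ {c g g'} → g ⊑ g' → node c g ⊑ᵗ node c g'
    duplicated : ∀ {g g₁ g₂} → g ⊑ g₁ → g ⊑ g₂ → node white g ⊑ᵗ node black (g₁ ++ g₂)

  data _⊑_ : Forest → Forest → Set where
    []  : [] ⊑ []
    _∷_ : ∀ {t t' g g'} → t ⊑ᵗ t' → g ⊑ g' → (t ∷ g) ⊑ (t' ∷ g')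

mutual
  ⊑ᵗ-refl : ∀ t → t ⊑ᵗ t
  ⊑ᵗ-refl (node _ g) = same (⊑-refl g)

  ⊑-refl : ∀ f → f ⊑ f
  ⊑-refl []      = []
  ⊑-refl (t ∷ f) = ⊑ᵗ-refl t ∷ ⊑-refl f

⊑-length : ∀ {f f'} → f ⊑ f' → length f ≡ length f'
⊑-length []      = refl
⊑-length (_ ∷ q) = cong suc (⊑-length q)

⊑-take : ∀ k {f f'} → f ⊑ f' → take k f ⊑ take k f'
⊑-take zero    _       = []
⊑-take (suc k) []      = []
⊑-take (suc k) (p ∷ q) = p ∷ ⊑-take k q

⊑-drop : ∀ k {f f'} → f ⊑ f' → drop k f ⊑ drop k f'
⊑-drop zero    q       = q
⊑-drop (suc k) []      = []
⊑-drop (suc k) (_ ∷ q) = ⊑-drop k q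

mutual
  ⊑ᵗ-⋖ : ∀ {t t₁ t₂} → t ⊑ᵗ t₁ → t₁ ⋖T t₂ → t ⊑ᵗ t₂
  ⊑ᵗ-⋖ (same {white} p) (dup _)   = duplicated p p
  ⊑ᵗ-⋖ (same p)         (below s) = same (⊑-⋖ p s)
  ⊑ᵗ-⋖ (duplicated {g₁ = g₁} p₁ p₂) (below s) with ⋖-++⁻ g₁ s
  ... | inj₁ (_ , s₁ , refl) = duplicated (⊑-⋖ p₁ s₁) p₂
  ... | inj₂ (_ , s₂ , refl) = duplicated p₁ (⊑-⋖ p₂ s₂)

  ⊑-⋖ : ∀ {f f₁ f₂} → f ⊑ f₁ → f₁ ⋖F f₂ → f ⊑ f₂
  ⊑-⋖ (p ∷ q) (here s)  = ⊑ᵗ-⋖ p s ∷ q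
  ⊑-⋖ (p ∷ q) (there s) = p ∷ ⊑-⋖ q s

⊑-≪ : ∀ {f f₁ f₂} → f ⊑ f₁ → f₁ ≪ f₂ → f ⊑ f₂
⊑-≪ p ε        = p
⊑-≪ p (s ◅ ss) = ⊑-≪ (⊑-⋖ p s) ss

≪⇒⊑ : ∀ {f f'} → f ≪ f' → f ⊑ f'
≪⇒⊑ {f} = ⊑-≪ (⊑-refl f)

-- depthF f ≤ n says that encodeF n f reaches no subforest of f at depth 0.
mutual
  depthT : Tree → ℕ
  depthT (node _ g) = suc (depthF g)

  depthF : Forest → ℕ
  depthF []      = 1
  depthF (t ∷ g) = suc (depthT t ⊔ depthF g)

0<depthF : ∀ f → 0 < depthF f
0<depthF []      = s≤s z≤n
0<depthF (_ ∷ _) = s≤s z≤n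

depthF-take : ∀ k f → depthF (take k f) ≤ depthF f
depthF-take zero    f       = 0<depthF f
depthF-take (suc k) []      = ≤-refl
depthF-take (suc k) (t ∷ f) = s≤s (⊔-monoʳ-≤ (depthT t) (depthF-take k f))

depthF-drop : ∀ k f → depthF (drop k f) ≤ depthF f
depthF-drop zero    f       = ≤-refl
depthF-drop (suc k) []      = ≤-refl
depthF-drop (suc k) (t ∷ f) = m≤n⇒m≤1+n (≤-trans (depthF-drop k f) (m≤n⊔m (depthT t) (depthF f)))

-- The forest below supplies what a term alone does not determine: the length of each
-- forest and the split point of each black node.
mutual
  decodeT : ℕ → Tree → Term → Tree
  decodeT zero    t              _         = t
  decodeT (suc n) (node white g) u         = decodeWhite n g u
  decodeT (suc n) (node black h) (v₁ · v₂) =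
    node black (decodeF n (take (half h) h) v₁ ++ decodeF n (drop (half h) h) v₂)
  decodeT (suc n) t              _         = t

  decodeWhite : ℕ → Forest → Term → Tree
  decodeWhite n g (M · v) = node white (decodeF n g v)
  decodeWhite n g (s · v) = node black (decodeF n g s ++ decodeF n g v)
  decodeWhite n g _       = node white g

  decodeF : ℕ → Forest → Term → Forest
  decodeF zero    f       _         = f
  decodeF (suc n) []      _         = []
  decodeF (suc n) (t ∷ g) (v₁ · v₂) = decodeT n t v₁ ∷ decodeF n g v₂
  decodeF (suc n) f       _         = f

decodeWhite-· : ∀ n g {s v} → ¬ s ≡ M →
  decodeWhite n g (s · v) ≡ node black (decodeF n g s ++ decodeF n g v)
decodeWhite-· n g {var _} _   = refl
decodeWhite-· n g {M}     s≢M = ⊥-elim (s≢M refl)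
decodeWhite-· n g {_ · _} _   = refl

mutual
  decodeT-encodeT : ∀ n {t t'} → depthT t ≤ n → t ⊑ᵗ t' → decodeT n t (encodeT n t') ≡ t'
  decodeT-encodeT zero {node _ _} () _
  decodeT-encodeT (suc n) {node white g} (s≤s d) (same p) =
    cong (node white) (decodeF-encodeF n d p)
  decodeT-encodeT (suc zero) {node white g} (s≤s d) (duplicated _ _) =
    ⊥-elim (<⇒≱ (0<depthF g) d)
  decodeT-encodeT (suc (suc n)) {node white g} (s≤s d) (duplicated {g₁ = g₁} {g₂} p₁ p₂) = begin
    decodeWhite (suc n) g (encodeT (suc (suc n)) (node black (g₁ ++ g₂)))
      ≡⟨ cong (decodeWhite (suc n) g) (encodeT-halves (suc n) halves-g₁-g₂) ⟩
    decodeWhite (suc n) g (encodeF (suc n) g₁ · encodeF (suc n) g₂)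
      ≡⟨ decodeWhite-· (suc n) g (encodeF-≢M n g₁) ⟩
    node black (decodeF (suc n) g (encodeF (suc n) g₁) ++ decodeF (suc n) g (encodeF (suc n) g₂))
      ≡⟨ cong₂ (λ x y → node black (x ++ y)) (decodeF-encodeF (suc n) d p₁) (decodeF-encodeF (suc n) d p₂) ⟩
    node black (g₁ ++ g₂) ∎
    where
    halves-g₁-g₂ : Halves g₁ g₂
    halves-g₁-g₂ = halves-resp-length refl (trans (sym (⊑-length p₁)) (⊑-length p₂)) (halves-dup g₁)
  decodeT-encodeT (suc n) {node black h} {node black h'} (s≤s d) (same p) rewrite ⊑-length p =
    cong (node black) (trans
      (cong₂ _++_ (decodeF-encodeF n (≤-trans (depthF-take k h) d) (⊑-take k p))
                  (decodeF-encodeF n (≤-trans (depthF-drop k h) d) (⊑-drop k p)))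
      (take++drop≡id k h'))
    where
    k : ℕ
    k = half h'

  decodeF-encodeF : ∀ n {f f'} → depthF f ≤ n → f ⊑ f' → decodeF n f (encodeF n f') ≡ f'
  decodeF-encodeF zero    {[]}    () _
  decodeF-encodeF zero    {_ ∷ _} () _
  decodeF-encodeF (suc n) _       []      = refl
  decodeF-encodeF (suc n) (s≤s d) (p ∷ q) = cong₂ _∷_
    (decodeT-encodeT n (m⊔n≤o⇒m≤o _ _ d) p) (decodeF-encodeF n (m⊔n≤o⇒n≤o _ _ d) q)

encodeF-injective : ∀ {n f f₁ f₂} → depthF f ≤ n → f ≪ f₁ → f ≪ f₂ →
  encodeF n f₁ ≡ encodeF n f₂ → f₁ ≡ f₂
encodeF-injective {n} {f} {f₁} {f₂} d p₁ p₂ e = begin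
  f₁                          ≡⟨ decodeF-encodeF n d (≪⇒⊑ p₁) ⟨
  decodeF n f (encodeF n f₁)  ≡⟨ cong (decodeF n f) e ⟩
  decodeF n f (encodeF n f₂)  ≡⟨ decodeF-encodeF n d (≪⇒⊑ p₂) ⟩
  f₂                          ∎

dstar≅interval : ∀ n f → depthF f ≤ n → DStar≅Interval f n (encodeF n f)
dstar≅interval n f d = record
  { to      = encodeF n
  ; from    = decodeF n f
  ; to-in-M = λ f' _ → r≼encodeF n f'
  ; to-in   = λ _ p → encodeF-mono⋆ n p
  ; from-in = λ u _ q → from-in u q
  ; from-to = λ _ p → decodeF-encodeF n d (≪⇒⊑ p)
  ; to-from = λ u _ q → to-from u q
  ; mono    = λ _ _ _ _ p → encodeF-mono⋆ n p
  ; reflect = λ _ _ p₁ p₂ q → reflect p₁ p₂ q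
  }
  where
  from-in : ∀ u → encodeF n f ≼ u → f ≪ decodeF n f u
  from-in u q with encodeF-lift⋆ n f q
  ... | f' , p , refl = subst (f ≪_) (sym (decodeF-encodeF n d (≪⇒⊑ p))) p

  to-from : ∀ u → encodeF n f ≼ u → encodeF n (decodeF n f u) ≡ u
  to-from u q with encodeF-lift⋆ n f q
  ... | f' , p , refl = cong (encodeF n) (decodeF-encodeF n d (≪⇒⊑ p))

  reflect : ∀ {f₁ f₂} → f ≪ f₁ → f ≪ f₂ → encodeF n f₁ ≼ encodeF n f₂ → f₁ ≪ f₂
  reflect {f₁} p₁ p₂ q with encodeF-lift⋆ n f₁ q
  ... | f₃ , p , e = subst (f₁ ≪_) (encodeF-injective d (p₁ ◅◅ p) p₂ e) p

theorem2p3p5 : (f : Forest) →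
    Σ ℕ (λ d → Σ Term (λ a → (r d ≼ a) × DStar≅Interval f d a))
theorem2p3p5 f = n , encodeF n f , r≼encodeF n f , dstar≅interval n f ≤-refl
  where
  n : ℕ
  n = depthF f
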